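{- Let $G$ be a 2-connected graph that does not contain the diamond as a contraction. Then $G$ is either a cycle or a complete graph.
   Context: Graphs are finite, simple. Contracting an edge $\{u,v\}$ means adding a new vertex adjacent to all neighbours of $u$ and $v$ and deleting $u,v$; $H$ is a contraction of $G$ if obtained by a sequence of edge contractions. The diamond is $K_4$ minus an edge. -}

module Defs where

open import Data.Nat using (ℕ; suc; _≤_; _%_; NonZero)
open import Data.Fin using (Fin; toℕ; zero; suc)
open import Data.Bool using (Bool; true; false; _∧_; not)
open import Data.Product using (Σ; _×_; _,_; ∃; ∃-syntax)
open import Data.Sum using (_⊎_)
open import Data.Unit using (⊤)
open import Relation.Nullary using (¬_)
open import Relation.Nullary.Decidable using (⌊_⌋)
open import Relation.Binary.PropositionalEquality using (_≡_; _≢_)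
open import Relation.Binary.Construct.Closure.ReflexiveTransitive using (Star)
open import Function.Bundles using (_↔_; Inverse; _⇔_)
import Data.Nat as ℕ
import Data.Fin as F

record Graph : Set where
  field
    n     : ℕ
    adj   : Fin n → Fin n → Bool
    sym   : ∀ x y → adj x y ≡ adj y x
    irrfl : ∀ x → adj x x ≡ false

open Graph public

V : Graph → Set
V G = Fin (n G)

Adj : (G : Graph) → V G → V G → Set
Adj G x y = adj G x y ≡ true

record _≅_ (G H : Graph) : Set where
  field
    bij : V G ↔ V H
  open Inverse bij public using (to)
  field
    pres : ∀ x y → adj G x y ≡ adj H (to x) (to y)

data Reach (G : Graph) (P : V G → Set) : V G → V G → Set where
  here : ∀ {x} → P x → Reach G P x x
  step : ∀ {x y z} → P x → Adj G x y → Reach G P y z → Reach G P x z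

Connected : Graph → Set
Connected G = ∀ x y → Reach G (λ _ → ⊤) x y

TwoConnected : Graph → Set
TwoConnected G =
  (3 ≤ n G) × Connected G ×
  (∀ (w x y : V G) → x ≢ w → y ≢ w → Reach G (λ z → z ≢ w) x y)

-- H is (isomorphic to) the graph obtained from G by contracting one edge {u,v}:
-- φ identifies exactly u and v, and for distinct vertices a, b of H,
-- a ~ b iff some edge of G joins a preimage of a to a preimage of b.
record EdgeContraction (G H : Graph) : Set where
  field
    u v   : V G
    uv    : Adj G u v
    φ     : V G → V H
    surj  : ∀ a → ∃[ x ] φ x ≡ a
    merge : φ u ≡ φ v
    inj   : ∀ x y → φ x ≡ φ y → (x ≡ y) ⊎ ((x ≡ u × y ≡ v) ⊎ (x ≡ v × y ≡ u))
    adjH  : ∀ a b → a ≢ b →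
            Adj H a b ⇔ (∃[ x ] ∃[ y ] (φ x ≡ a × φ y ≡ b × Adj G x y))

_IsContractionOf_ : Graph → Graph → Set
H IsContractionOf G = Star EdgeContraction G H

-- The diamond K4 minus the edge {0,3}.
diamondAdj : Fin 4 → Fin 4 → Bool
diamondAdj i j = not ⌊ i F.≟ j ⌋ ∧ not (⌊ toℕ i ℕ.+ toℕ j ℕ.≟ 3 ⌋ ∧ ⌊ toℕ i ℕ.* toℕ j ℕ.≟ 0 ⌋)

diamondAdj-sym : ∀ x y → diamondAdj x y ≡ diamondAdj y x
diamondAdj-sym zero zero = _≡_.refl
diamondAdj-sym zero (suc zero) = _≡_.refl
diamondAdj-sym zero (suc (suc zero)) = _≡_.refl
diamondAdj-sym zero (suc (suc (suc zero))) = _≡_.refl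
diamondAdj-sym (suc zero) zero = _≡_.refl
diamondAdj-sym (suc zero) (suc zero) = _≡_.refl
diamondAdj-sym (suc zero) (suc (suc zero)) = _≡_.refl
diamondAdj-sym (suc zero) (suc (suc (suc zero))) = _≡_.refl
diamondAdj-sym (suc (suc zero)) zero = _≡_.refl
diamondAdj-sym (suc (suc zero)) (suc zero) = _≡_.refl
diamondAdj-sym (suc (suc zero)) (suc (suc zero)) = _≡_.refl
diamondAdj-sym (suc (suc zero)) (suc (suc (suc zero))) = _≡_.refl
diamondAdj-sym (suc (suc (suc zero))) zero = _≡_.refl
diamondAdj-sym (suc (suc (suc zero))) (suc zero) = _≡_.refl
diamondAdj-sym (suc (suc (suc zero))) (suc (suc zero)) = _≡_.refl
diamondAdj-sym (suc (suc (suc zero))) (suc (suc (suc zero))) = _≡_.refl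

diamondAdj-irr : ∀ x → diamondAdj x x ≡ false
diamondAdj-irr zero = _≡_.refl
diamondAdj-irr (suc zero) = _≡_.refl
diamondAdj-irr (suc (suc zero)) = _≡_.refl
diamondAdj-irr (suc (suc (suc zero))) = _≡_.refl

Diamond : Graph
Diamond = record { n = 4 ; adj = diamondAdj ; sym = diamondAdj-sym ; irrfl = diamondAdj-irr }

HasDiamondContraction : Graph → Set
HasDiamondContraction G = ∃[ H ] (H IsContractionOf G × H ≅ Diamond)

CycSucc : (m : ℕ) → Fin m → Fin m → Set
CycSucc m i j = (suc (toℕ i) ≡ toℕ j) ⊎ (suc (toℕ i) ≡ m × toℕ j ≡ 0)

IsCycle : Graph → Set
IsCycle G = (3 ≤ n G) ×
  Σ (Fin (n G) ↔ V G) (λ σ → ∀ i j →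
     Adj G (Inverse.to σ i) (Inverse.to σ j) ⇔ (CycSucc (n G) i j ⊎ CycSucc (n G) j i))

IsComplete : Graph → Set
IsComplete G = ∀ (x y : V G) → x ≢ y → Adj G x y

-- A model of H in G (connected, disjoint branch sets, two of them joined by an edge exactly when the
-- corresponding vertices of H are adjacent) becomes H after contracting the edges inside branch sets,
-- so it is enough to rule out diamond models.
-- Let G be 2-connected and diamond-free, neither complete nor of maximum degree 2, and let z have degree
-- at least 3. A universal vertex and a non-edge give a diamond model, so z has a non-neighbour, hence a
-- neighbour c with a neighbour t not adjacent to z. If G - z - c had distinct components C and C′, then
-- C, z with the remaining components, c, and C′ would be the branch sets of a diamond model. So G/zc is
-- again 2-connected and diamond-free, and its merged vertex still has degree at least 3; it is not complete
-- either, for then G - z - c would be a clique all of whose vertices see z or c, once more giving a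
-- diamond model. Induction on the number of vertices excludes such G. Finally, if G has maximum degree 2,
-- a non-backtracking walk first repeats a vertex at its start, after visiting every vertex: G is a cycle.

module Submission where

open import Defs hiding (sym)
open import Data.Nat as ℕ using (ℕ; zero; suc; _≤_; _<_; z≤n; s≤s)
import Data.Nat.Properties as ℕ
open import Data.Nat.Induction using (<-wellFounded)
open import Data.Fin as F using (Fin; toℕ; fromℕ<; punchIn; punchOut; _≟_)
open import Data.Fin.Patterns
import Data.Fin.Properties as F
open import Data.Fin.Properties using (any?)
open import Data.Fin.Subset using (Subset; ⊤; _∈_; _-_; _⊂_)
open import Data.Fin.Subset.Properties using (_∈?_; ∈⊤; p─q⊆p; x∈p∧x≢y⇒x∈p-y; x∈p⇒p-x⊂p)
open import Data.Fin.Subset.Induction using (⊂-wellFounded)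
open import Data.Fin.Permutation using (↔⇒≡)
open import Data.Bool using (Bool; true; false)
import Data.Bool as Bool
open import Data.Bool.Properties using (⇔→≡)
open import Data.Product using (Σ; ∃; ∃₂; _×_; _,_; proj₁; proj₂)
open import Data.Sum using (_⊎_; inj₁; inj₂; [_,_]′)
open import Data.Unit using (tt)
open import Data.Empty using (⊥-elim)
open import Function using (_∘_; const)
open import Function.Bundles using (_⇔_; mk⇔; Equivalence; _↔_; mk↔ₛ′; Inverse)
open import Induction.WellFounded using (Acc; acc)
open import Relation.Nullary using (¬_; Dec; yes; no; does; ¬?; _×-dec_; contradiction)
open import Relation.Nullary.Decidable using (dec-false)
open import Relation.Unary using (Decidable)
open import Relation.Binary.Definitions using (tri<; tri≈; tri>)
open import Relation.Binary.PropositionalEquality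
  using (_≡_; _≢_; refl; sym; trans; cong; subst; subst₂)
open import Relation.Binary.Construct.Closure.ReflexiveTransitive using (ε; _◅_)

adj-sym : (G : Graph) {x y : V G} → Adj G x y → Adj G y x
adj-sym G {x} {y} = trans (Graph.sym G y x)

adj⇒≢ : (G : Graph) {x y : V G} → Adj G x y → x ≢ y
adj⇒≢ G {x} xy refl with trans (sym (irrfl G x)) xy
... | ()

adj? : (G : Graph) (x y : V G) → Dec (Adj G x y)
adj? G x y = adj G x y Bool.≟ true

does≡true⇔ : ∀ {A : Set} (a? : Dec A) → does a? ≡ true ⇔ A
does≡true⇔ (yes a) = mk⇔ (const a) (const refl)
does≡true⇔ (no ¬a) = mk⇔ (λ ()) (λ a → contradiction a ¬a)

module _ {G : Graph} where

  reach-start : ∀ {P x y} → Reach G P x y → P x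
  reach-start (here p)     = p
  reach-start (step p _ _) = p

  reach-end : ∀ {P x y} → Reach G P x y → P y
  reach-end (here p)     = p
  reach-end (step _ _ r) = reach-end r

  reach-mono : ∀ {P Q : V G → Set} → (∀ {z} → P z → Q z) → ∀ {x y} → Reach G P x y → Reach G Q x y
  reach-mono f (here p)     = here (f p)
  reach-mono f (step p a r) = step (f p) a (reach-mono f r)

  reach-++ : ∀ {P x y z} → Reach G P x y → Reach G P y z → Reach G P x z
  reach-++ (here _)     r′ = r′
  reach-++ (step p a r) r′ = step p a (reach-++ r r′)

  reach-snoc : ∀ {P x y z} → Reach G P x y → Adj G y z → P z → Reach G P x z
  reach-snoc r a pz = reach-++ r (step (reach-end r) a (here pz))

  reach-reverse : ∀ {P x y} → Reach G P x y → Reach G P y x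
  reach-reverse (here p)     = here p
  reach-reverse (step p a r) = reach-snoc (reach-reverse r) (adj-sym G a) p

  reach-invariant : ∀ {P R : V G → Set} → (∀ {a b} → P a → R a → Adj G a b → P b → R b) →
                    ∀ {x y} → R x → Reach G P x y → Reach G (λ z → P z × R z) x y
  reach-invariant prop rx (here p)     = here (p , rx)
  reach-invariant prop rx (step p a r) = step (p , rx) a (reach-invariant prop (prop p rx a (reach-start r)) r)

  reach-lastStep : ∀ {P z t} → Reach G P z t → z ≢ t →
                   ∃ λ p → Reach G (λ w → P w × w ≢ t) z p × Adj G p t
  reach-lastStep (here _) z≢t = contradiction refl z≢t
  reach-lastStep {t = t} (step {y = w} p a r) z≢t with w ≟ t
  ... | yes refl = _ , here (p , z≢t) , a
  ... | no w≢t   = let q , r′ , a′ = reach-lastStep r w≢t in q , step (p , z≢t) a r′ , a′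

  reach-avoiding : ∀ {P z y} (x : V G) → Reach G P z y → x ≢ y →
                   Reach G (λ u → P u × u ≢ x) z y ⊎
                   ∃ λ w → Adj G x w × Reach G (λ u → P u × u ≢ x) w y
  reach-avoiding x (here p) x≢y = inj₁ (here (p , x≢y ∘ sym))
  reach-avoiding {z = z} x (step {y = w} p a r) x≢y with reach-avoiding x r x≢y | z ≟ x
  ... | inj₂ h  | _        = inj₂ h
  ... | inj₁ r′ | yes refl = inj₂ (w , a , r′)
  ... | inj₁ r′ | no z≢x   = inj₁ (step (p , z≢x) a r′)

reach-map : ∀ {G H : Graph} {P : V G → Set} {Q : V H → Set} (f : V G → V H) →
            (∀ {x y} → Adj G x y → f x ≡ f y ⊎ Adj H (f x) (f y)) →
            (∀ {z} → P z → Q (f z)) → ∀ {x y} → Reach G P x y → Reach H Q (f x) (f y)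
reach-map f f-adj f-P (here p) = here (f-P p)
reach-map f f-adj f-P (step p a r) with f-adj a
... | inj₁ fx≡fy rewrite fx≡fy = reach-map f f-adj f-P r
... | inj₂ a′                  = step (f-P p) a′ (reach-map f f-adj f-P r)

module _ (G : Graph) {P : V G → Set} (P? : Decidable P) where

  reachWithin? : (S : Subset (n G)) → Acc _⊂_ S → ∀ x y → Dec (Reach G (λ z → P z × z ∈ S) x y)
  reachWithin? S (acc rec) x y with P? x ×-dec x ∈? S | x ≟ y
  ... | no ¬px           | _        = no (¬px ∘ reach-start)
  ... | yes px           | yes refl = yes (here px)
  ... | yes px@(_ , x∈S) | no x≢y
    with any? (λ w → adj? G x w ×-dec reachWithin? (S - x) (rec (x∈p⇒p-x⊂p x∈S)) w y)
  ... | yes (w , a , r) = yes (step px a (reach-mono (λ (pz , z∈S-x) → pz , p─q⊆p S _ z∈S-x) r))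
  ... | no ¬w = no λ r → [ (λ r′ → proj₂ (reach-start r′) refl)
                         , (λ (w , a , r′) → ¬w (w , a , reach-mono shrink r′)) ]′ (reach-avoiding x r x≢y)
    where
      shrink : ∀ {z} → (P z × z ∈ S) × z ≢ x → P z × z ∈ S - x
      shrink ((pz , z∈S) , z≢x) = pz , x∈p∧x≢y⇒x∈p-y z∈S z≢x

  reach? : ∀ x y → Dec (Reach G P x y)
  reach? x y with reachWithin? ⊤ (⊂-wellFounded ⊤) x y
  ... | yes r = yes (reach-mono proj₁ r)
  ... | no ¬r = no (¬r ∘ reach-mono (_, ∈⊤))

-- Edge contractions and models

record Contraction (G : Graph) (u v : V G) : Set where
  field
    H       : Graph
    edge    : Adj G u v
    φ       : V G → V H
    ψ       : V H → V G
    φ∘ψ     : ∀ a → φ (ψ a) ≡ a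
    ψ∘φ     : ∀ {x} → x ≢ v → ψ (φ x) ≡ x
    ψ∘φ-v   : ψ (φ v) ≡ u
    adj⇔    : ∀ {a b} → a ≢ b → Adj H a b ⇔ ∃₂ λ x y → φ x ≡ a × φ y ≡ b × Adj G x y
    shrinks : n H < n G

  merge : φ u ≡ φ v
  merge = trans (cong φ (sym ψ∘φ-v)) (φ∘ψ (φ v))

  private
    ψ∘φ-cases : ∀ x → (x ≡ v × ψ (φ x) ≡ u) ⊎ (ψ (φ x) ≡ x)
    ψ∘φ-cases x with x ≟ v
    ... | yes refl = inj₁ (refl , ψ∘φ-v)
    ... | no x≢v   = inj₂ (ψ∘φ x≢v)

  φ-identifies-only-uv : ∀ x y → φ x ≡ φ y → x ≡ y ⊎ (x ≡ u × y ≡ v ⊎ x ≡ v × y ≡ u)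
  φ-identifies-only-uv x y φx≡φy with ψ∘φ-cases x | ψ∘φ-cases y
  ... | inj₁ (refl , _)  | inj₁ (refl , _)  = inj₁ refl
  ... | inj₁ (refl , ψx) | inj₂ ψy          = inj₂ (inj₂ (refl , trans (sym ψy) (trans (cong ψ (sym φx≡φy)) ψx)))
  ... | inj₂ ψx          | inj₁ (refl , ψy) = inj₂ (inj₁ (trans (sym ψx) (trans (cong ψ φx≡φy) ψy) , refl))
  ... | inj₂ ψx          | inj₂ ψy          = inj₁ (trans (sym ψx) (trans (cong ψ φx≡φy) ψy))

  φ-adj : ∀ {x y} → Adj G x y → φ x ≡ φ y ⊎ Adj H (φ x) (φ y)
  φ-adj {x} {y} xy with φ x ≟ φ y
  ... | yes φx≡φy = inj₁ φx≡φy
  ... | no φx≢φy  = inj₂ (Equivalence.from (adj⇔ φx≢φy) (x , y , refl , refl , xy))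

  reach-project : ∀ {P : V G → Set} {Q : V H → Set} → (∀ {x} → P x → Q (φ x)) →
                  ∀ {a b} → Reach G P (ψ a) (ψ b) → Reach H Q a b
  reach-project {Q = Q} f {a} {b} r = subst₂ (Reach H Q) (φ∘ψ a) (φ∘ψ b) (reach-map φ φ-adj f r)

  edgeContraction : EdgeContraction G H
  edgeContraction = record
    { u = u ; v = v ; uv = edge ; φ = φ ; surj = λ a → ψ a , φ∘ψ a ; merge = merge
    ; inj = φ-identifies-only-uv ; adjH = λ a b → adj⇔ }

module Contract {m : ℕ} (a : Fin (suc m) → Fin (suc m) → Bool)
                (a-sym : ∀ x y → a x y ≡ a y x) (a-irr : ∀ x → a x x ≡ false)
                {u v : Fin (suc m)} (uv : a u v ≡ true) where

  G : Graph
  G = record { n = suc m ; adj = a ; sym = a-sym ; irrfl = a-irr }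

  v≢u : v ≢ u
  v≢u = adj⇒≢ G uv ∘ sym

  φ : V G → Fin m
  φ x with v ≟ x
  ... | yes _  = punchOut v≢u
  ... | no v≢x = punchOut v≢x

  ψ : Fin m → V G
  ψ = punchIn v

  φ-≢v : ∀ {x} (v≢x : v ≢ x) → φ x ≡ punchOut v≢x
  φ-≢v {x} v≢x with v ≟ x
  ... | yes v≡x = contradiction v≡x v≢x
  ... | no _    = F.punchOut-cong v refl

  φ∘ψ : ∀ b → φ (ψ b) ≡ b
  φ∘ψ b = trans (φ-≢v (F.punchInᵢ≢i v b ∘ sym)) (trans (F.punchOut-cong v refl) (F.punchOut-punchIn v))

  ψ∘φ : ∀ {x} → x ≢ v → ψ (φ x) ≡ x
  ψ∘φ x≢v = trans (cong ψ (φ-≢v (x≢v ∘ sym))) (F.punchIn-punchOut _)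

  ψ∘φ-v : ψ (φ v) ≡ u
  ψ∘φ-v with v ≟ v
  ... | yes _  = F.punchIn-punchOut v≢u
  ... | no v≢v = contradiction refl v≢v

  Joined : Fin m → Fin m → Set
  Joined p q = ∃₂ λ x y → φ x ≡ p × φ y ≡ q × Adj G x y

  joined? : ∀ p q → Dec (Joined p q)
  joined? p q = any? λ x → any? λ y → φ x ≟ p ×-dec φ y ≟ q ×-dec adj? G x y

  joined-sym : ∀ {p q} → Joined p q → Joined q p
  joined-sym (x , y , φx , φy , xy) = y , x , φy , φx , adj-sym G xy

  adjH : Fin m → Fin m → Bool
  adjH p q = does (¬? (p ≟ q) ×-dec joined? p q)

  adjH⇔ : ∀ p q → adjH p q ≡ true ⇔ (p ≢ q × Joined p q)
  adjH⇔ p q = does≡true⇔ (¬? (p ≟ q) ×-dec joined? p q)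

  adjH-sym : ∀ p q → adjH p q ≡ adjH q p
  adjH-sym p q = ⇔→≡ (mk⇔ (flip p q) (flip q p))
    where
      flip : ∀ p q → adjH p q ≡ true → adjH q p ≡ true
      flip p q pq = let p≢q , j = Equivalence.to (adjH⇔ p q) pq
                    in Equivalence.from (adjH⇔ q p) (p≢q ∘ sym , joined-sym j)

  adjH-irr : ∀ p → adjH p p ≡ false
  adjH-irr p = dec-false (¬? (p ≟ p) ×-dec joined? p p) λ (p≢p , _) → p≢p refl

  H : Graph
  H = record { n = m ; adj = adjH ; sym = adjH-sym ; irrfl = adjH-irr }

  contraction : Contraction G u v
  contraction = record
    { H = H ; edge = uv ; φ = φ ; ψ = ψ ; φ∘ψ = φ∘ψ ; ψ∘φ = ψ∘φ ; ψ∘φ-v = ψ∘φ-v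
    ; adj⇔ = λ {p} {q} p≢q → mk⇔ (proj₂ ∘ Equivalence.to (adjH⇔ p q))
                                   (λ j → Equivalence.from (adjH⇔ p q) (p≢q , j))
    ; shrinks = ℕ.n<1+n m }

contract : (G : Graph) {u v : V G} → Adj G u v → Contraction G u v
contract record { n = zero } {u = ()}
contract record { n = suc m ; adj = a ; sym = a-sym ; irrfl = a-irr } uv = Contract.contraction a a-sym a-irr uv

record Model (G H : Graph) : Set where
  field
    branch            : V G → V H
    branch-surjective : ∀ a → ∃ λ x → branch x ≡ a
    branch-connected  : ∀ {x y} → branch x ≡ branch y → Reach G (λ z → branch z ≡ branch x) x y
    adj⇔              : ∀ {a b} → a ≢ b → Adj H a b ⇔ ∃₂ λ x y → branch x ≡ a × branch y ≡ b × Adj G x y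

module _ {H : Graph} where

  injectiveModel⇒≅ : {G : Graph} (M : Model G H) →
                     (∀ {x y} → Model.branch M x ≡ Model.branch M y → x ≡ y) → G ≅ H
  injectiveModel⇒≅ {G} M branch-injective = record { bij = mk↔ₛ′ branch from branch∘from from∘branch ; pres = pres }
    where
      open Model M
      from : V H → V G
      from a = proj₁ (branch-surjective a)
      branch∘from : ∀ a → branch (from a) ≡ a
      branch∘from a = proj₂ (branch-surjective a)
      from∘branch : ∀ x → from (branch x) ≡ x
      from∘branch x = branch-injective (branch∘from (branch x))
      pres : ∀ x y → adj G x y ≡ adj H (branch x) (branch y)
      pres x y with x ≟ y
      ... | yes refl = trans (irrfl G x) (sym (irrfl H (branch x)))
      ... | no x≢y   = ⇔→≡ (mk⇔
            (λ xy → Equivalence.from (adj⇔ bx≢by) (x , y , refl , refl , xy))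
            (λ h → let x′ , y′ , bx′ , by′ , x′y′ = Equivalence.to (adj⇔ bx≢by) h
                   in subst₂ (Adj G) (branch-injective bx′) (branch-injective by′) x′y′))
        where
          bx≢by : branch x ≢ branch y
          bx≢by = x≢y ∘ branch-injective

  model-contract : {G : Graph} (M : Model G H) {u w : V G} (C : Contraction G u w) →
                   Model.branch M w ≡ Model.branch M u → Model (Contraction.H C) H
  model-contract {G} M {u} {w} C bw≡bu = record
    { branch            = branch′
    ; branch-surjective = λ a → let x , bx = branch-surjective a in φ x , trans (branch′∘φ x) bx
    ; branch-connected  = connected′
    ; adj⇔              = λ a≢b → mk⇔ (to′ a≢b) (from′ a≢b) }
    where
      open Model M
      open Contraction C using (φ; ψ; ψ∘φ; ψ∘φ-v; φ-adj; reach-project) renaming (H to G′; adj⇔ to adj′⇔)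
      branch′ : V G′ → V H
      branch′ p = branch (ψ p)
      branch′∘φ : ∀ z → branch′ (φ z) ≡ branch z
      branch′∘φ z with z ≟ w
      ... | yes refl = trans (cong branch ψ∘φ-v) (sym bw≡bu)
      ... | no z≢w   = cong branch (ψ∘φ z≢w)
      connected′ : ∀ {p q} → branch′ p ≡ branch′ q → Reach G′ (λ z → branch′ z ≡ branch′ p) p q
      connected′ bp≡bq = reach-project (λ {z} bz → trans (branch′∘φ z) bz) (branch-connected bp≡bq)
      to′ : ∀ {a b} → a ≢ b → Adj H a b → ∃₂ λ p q → branch′ p ≡ a × branch′ q ≡ b × Adj G′ p q
      to′ a≢b ab with Equivalence.to (adj⇔ a≢b) ab
      ... | x , y , bx , by , xy with φ-adj xy
      ...   | inj₁ φx≡φy = contradiction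
                (trans (sym bx) (trans (sym (branch′∘φ x)) (trans (cong branch′ φx≡φy) (trans (branch′∘φ y) by)))) a≢b
      ...   | inj₂ φxφy  = φ x , φ y , trans (branch′∘φ x) bx , trans (branch′∘φ y) by , φxφy
      from′ : ∀ {a b} → a ≢ b → (∃₂ λ p q → branch′ p ≡ a × branch′ q ≡ b × Adj G′ p q) → Adj H a b
      from′ a≢b (p , q , bp , bq , pq) with Equivalence.to (adj′⇔ (adj⇒≢ G′ pq)) pq
      ... | x , y , φx , φy , xy = Equivalence.from (adj⇔ a≢b)
              (x , y , trans (sym (branch′∘φ x)) (trans (cong branch′ φx) bp)
                     , trans (sym (branch′∘φ y)) (trans (cong branch′ φy) bq) , xy)

  model⇒contraction : (G : Graph) → Model G H → ∃ λ G′ → G′ IsContractionOf G × G′ ≅ H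
  model⇒contraction G = go G (<-wellFounded (n G))
    where
      go : (G : Graph) → Acc _<_ (n G) → Model G H → ∃ λ G′ → G′ IsContractionOf G × G′ ≅ H
      go G (acc rec) M with any? (λ x → any? (λ y → ¬? (x ≟ y) ×-dec Model.branch M x ≟ Model.branch M y))
      ... | no ¬shared = G , ε , injectiveModel⇒≅ M injective
        where
          injective : ∀ {x y} → Model.branch M x ≡ Model.branch M y → x ≡ y
          injective {x} {y} bx≡by with x ≟ y
          ... | yes x≡y = x≡y
          ... | no x≢y  = contradiction (x , y , x≢y , bx≡by) ¬shared
      ... | yes (x , y , x≢y , bx≡by) with Model.branch-connected M bx≡by
      ...   | here _ = contradiction refl x≢y
      ...   | step _ xw rest =
              let C = contract G xw
                  G″ , contractions , G″≅H = go (Contraction.H C) (rec (Contraction.shrinks C))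
                                               (model-contract M C (reach-start rest))
              in G″ , Contraction.edgeContraction C ◅ contractions , G″≅H

-- Diamond models

record DiamondModel (G : Graph) : Set where
  field
    branch            : V G → Fin 4
    branch-surjective : ∀ i → ∃ λ x → branch x ≡ i
    branch-connected  : ∀ i {x y} → branch x ≡ i → branch y ≡ i → Reach G (λ z → branch z ≡ i) x y
    no-edge-03        : ∀ {x y} → Adj G x y → branch x ≡ 0F → branch y ≢ 3F

  Joined : Fin 4 → Fin 4 → Set
  Joined i j = ∃₂ λ x y → branch x ≡ i × branch y ≡ j × Adj G x y

  field
    joined-01 : Joined 0F 1F
    joined-02 : Joined 0F 2F
    joined-12 : Joined 1F 2F
    joined-13 : Joined 1F 3F
    joined-23 : Joined 2F 3F

module _ {G : Graph} (D : DiamondModel G) where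
  open DiamondModel D

  private
    joined-sym : ∀ {i j} → Joined i j → Joined j i
    joined-sym (x , y , bx , by , xy) = y , x , by , bx , adj-sym G xy

    adj⇒joined : ∀ i j → Adj Diamond i j → Joined i j
    adj⇒joined 0F 1F _ = joined-01
    adj⇒joined 0F 2F _ = joined-02
    adj⇒joined 1F 0F _ = joined-sym joined-01
    adj⇒joined 1F 2F _ = joined-12
    adj⇒joined 1F 3F _ = joined-13
    adj⇒joined 2F 0F _ = joined-sym joined-02
    adj⇒joined 2F 1F _ = joined-sym joined-12
    adj⇒joined 2F 3F _ = joined-23
    adj⇒joined 3F 1F _ = joined-sym joined-13
    adj⇒joined 3F 2F _ = joined-sym joined-23
    adj⇒joined 0F 0F ()
    adj⇒joined 0F 3F ()
    adj⇒joined 1F 1F ()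
    adj⇒joined 2F 2F ()
    adj⇒joined 3F 0F ()
    adj⇒joined 3F 3F ()

    joined⇒adj : ∀ i j → i ≢ j → Joined i j → Adj Diamond i j
    joined⇒adj 0F 3F _ (x , y , bx , by , xy) = contradiction by (no-edge-03 xy bx)
    joined⇒adj 3F 0F _ (x , y , bx , by , xy) = contradiction bx (no-edge-03 (adj-sym G xy) by)
    joined⇒adj 0F 1F _ _ = refl
    joined⇒adj 0F 2F _ _ = refl
    joined⇒adj 1F 0F _ _ = refl
    joined⇒adj 1F 2F _ _ = refl
    joined⇒adj 1F 3F _ _ = refl
    joined⇒adj 2F 0F _ _ = refl
    joined⇒adj 2F 1F _ _ = refl
    joined⇒adj 2F 3F _ _ = refl
    joined⇒adj 3F 1F _ _ = refl
    joined⇒adj 3F 2F _ _ = refl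
    joined⇒adj 0F 0F i≢i _ = contradiction refl i≢i
    joined⇒adj 1F 1F i≢i _ = contradiction refl i≢i
    joined⇒adj 2F 2F i≢i _ = contradiction refl i≢i
    joined⇒adj 3F 3F i≢i _ = contradiction refl i≢i

  diamondModel⇒model : Model G Diamond
  diamondModel⇒model = record
    { branch            = branch
    ; branch-surjective = branch-surjective
    ; branch-connected  = λ {x} bx≡by → branch-connected (branch x) refl (sym bx≡by)
    ; adj⇔              = λ {i} {j} i≢j → mk⇔ (adj⇒joined i j) (joined⇒adj i j i≢j) }

  diamondModel⇒contraction : HasDiamondContraction G
  diamondModel⇒contraction = model⇒contraction G diamondModel⇒model

module InducedPath (G : Graph) {x s d : V G} (xs : Adj G x s) (sd : Adj G s d) (x≁d : ¬ Adj G x d) (x≢d : x ≢ d) where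

  Rest : V G → Set
  Rest z = z ≢ x × z ≢ s × z ≢ d

  branch : V G → Fin 4
  branch z with z ≟ x | z ≟ s | z ≟ d
  ... | yes _ | _     | _     = 0F
  ... | no _  | yes _ | _     = 2F
  ... | no _  | no _  | yes _ = 3F
  ... | no _  | no _  | no _  = 1F

  private
    x≢s : x ≢ s
    x≢s = adj⇒≢ G xs

    s≢d : s ≢ d
    s≢d = adj⇒≢ G sd

  branch-x : branch x ≡ 0F
  branch-x with x ≟ x
  ... | yes _  = refl
  ... | no x≢x = contradiction refl x≢x

  branch-s : branch s ≡ 2F
  branch-s with s ≟ x | s ≟ s
  ... | yes s≡x | _      = contradiction (sym s≡x) x≢s
  ... | no _    | yes _  = refl
  ... | no _    | no s≢s = contradiction refl s≢s

  branch-d : branch d ≡ 3F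
  branch-d with d ≟ x | d ≟ s | d ≟ d
  ... | yes d≡x | _       | _      = contradiction (sym d≡x) x≢d
  ... | no _    | yes d≡s | _      = contradiction (sym d≡s) s≢d
  ... | no _    | no _    | yes _  = refl
  ... | no _    | no _    | no d≢d = contradiction refl d≢d

  branch-Rest : ∀ {z} → Rest z → branch z ≡ 1F
  branch-Rest {z} (z≢x , z≢s , z≢d) with z ≟ x | z ≟ s | z ≟ d
  ... | yes z≡x | _       | _       = contradiction z≡x z≢x
  ... | no _    | yes z≡s | _       = contradiction z≡s z≢s
  ... | no _    | no _    | yes z≡d = contradiction z≡d z≢d
  ... | no _    | no _    | no _    = refl

  branch≡0 : ∀ {z} → branch z ≡ 0F → z ≡ x
  branch≡0 {z} _ with z ≟ x | z ≟ s | z ≟ d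
  branch≡0 _  | yes z≡x | _     | _     = z≡x
  branch≡0 () | no _    | yes _ | _
  branch≡0 () | no _    | no _  | yes _
  branch≡0 () | no _    | no _  | no _

  branch≡1 : ∀ {z} → branch z ≡ 1F → Rest z
  branch≡1 {z} _ with z ≟ x | z ≟ s | z ≟ d
  branch≡1 () | yes _   | _       | _
  branch≡1 () | no _    | yes _   | _
  branch≡1 () | no _    | no _    | yes _
  branch≡1 _  | no z≢x  | no z≢s  | no z≢d = z≢x , z≢s , z≢d

  branch≡2 : ∀ {z} → branch z ≡ 2F → z ≡ s
  branch≡2 {z} _ with z ≟ x | z ≟ s | z ≟ d
  branch≡2 () | yes _ | _       | _
  branch≡2 _  | no _  | yes z≡s | _     = z≡s
  branch≡2 () | no _  | no _    | yes _
  branch≡2 () | no _  | no _    | no _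

  branch≡3 : ∀ {z} → branch z ≡ 3F → z ≡ d
  branch≡3 {z} _ with z ≟ x | z ≟ s | z ≟ d
  branch≡3 () | yes _ | _     | _
  branch≡3 () | no _  | yes _ | _
  branch≡3 _  | no _  | no _  | yes z≡d = z≡d
  branch≡3 () | no _  | no _  | no _

  diamondModel : (∀ {y z} → Rest y → Rest z → Reach G Rest y z) →
                 (∃ λ r → Rest r × Adj G x r) → (∃ λ r → Rest r × Adj G s r) → (∃ λ r → Rest r × Adj G d r) →
                 DiamondModel G
  diamondModel rest-connected (rx , rx-rest , xrx) (rs , rs-rest , srs) (rd , rd-rest , drd) = record
    { branch            = branch
    ; branch-surjective = λ { 0F → x , branch-x ; 1F → rx , branch-Rest rx-rest ; 2F → s , branch-s ; 3F → d , branch-d }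
    ; branch-connected  = connected
    ; no-edge-03        = λ yz by≡0 bz≡3 → x≁d (subst₂ (Adj G) (branch≡0 by≡0) (branch≡3 bz≡3) yz)
    ; joined-01 = x  , rx , branch-x , branch-Rest rx-rest , xrx
    ; joined-02 = x  , s  , branch-x , branch-s , xs
    ; joined-12 = rs , s  , branch-Rest rs-rest , branch-s , adj-sym G srs
    ; joined-13 = rd , d  , branch-Rest rd-rest , branch-d , adj-sym G drd
    ; joined-23 = s  , d  , branch-s , branch-d , sd }
    where
      connected : ∀ i {y z} → branch y ≡ i → branch z ≡ i → Reach G (λ w → branch w ≡ i) y z
      connected 0F by bz rewrite branch≡0 by | branch≡0 bz = here branch-x
      connected 1F by bz = reach-mono branch-Rest (rest-connected (branch≡1 by) (branch≡1 bz))
      connected 2F by bz rewrite branch≡2 by | branch≡2 bz = here branch-s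
      connected 3F by bz rewrite branch≡3 by | branch≡3 bz = here branch-d

reach-leavesNeighbourhood : ∀ {G : Graph} {P : V G → Set} {z d} (x : V G) → Reach G P z d →
                            z ≡ x ⊎ Adj G x z → ¬ Adj G x d → x ≢ d →
                            ∃₂ λ c d′ → Adj G x c × Adj G c d′ × ¬ Adj G x d′ × x ≢ d′ × P c × P d′
reach-leavesNeighbourhood x (here _) (inj₁ refl) x≁d x≢d = contradiction refl x≢d
reach-leavesNeighbourhood x (here _) (inj₂ xd)   x≁d x≢d = contradiction xd x≁d
reach-leavesNeighbourhood {G} {z = z} x (step {y = w} pz zw r) near x≁d x≢d with w ≟ x | adj? G x w
... | yes w≡x | _      = reach-leavesNeighbourhood x r (inj₁ w≡x) x≁d x≢d
... | no _    | yes xw = reach-leavesNeighbourhood x r (inj₂ xw) x≁d x≢d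
... | no w≢x  | no x≁w with near
...   | inj₁ refl = contradiction zw x≁w
...   | inj₂ xz    = z , w , xz , zw , x≁w , w≢x ∘ sym , pz , reach-start r

universal+inducedPath⇒diamondModel :
  (G : Graph) (v : V G) → (∀ {y} → y ≢ v → Adj G v y) →
  ∀ {x s d} → Adj G x s → Adj G s d → ¬ Adj G x d → x ≢ d → x ≢ v → s ≢ v → d ≢ v → DiamondModel G
universal+inducedPath⇒diamondModel G v universal xs sd x≁d x≢d x≢v s≢v d≢v =
  diamondModel rest-connected (v , v-rest , adj-sym G (universal x≢v))
               (v , v-rest , adj-sym G (universal s≢v)) (v , v-rest , adj-sym G (universal d≢v))
  where
    open InducedPath G xs sd x≁d x≢d using (Rest; diamondModel)
    v-rest : Rest v
    v-rest = x≢v ∘ sym , s≢v ∘ sym , d≢v ∘ sym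
    toV : ∀ {y} → Rest y → Reach G Rest y v
    toV {y} y-rest with y ≟ v
    ... | yes refl = here y-rest
    ... | no y≢v   = step y-rest (adj-sym G (universal y≢v)) (here v-rest)
    rest-connected : ∀ {y z} → Rest y → Rest z → Reach G Rest y z
    rest-connected y-rest z-rest = reach-++ (toV y-rest) (reach-reverse (toV z-rest))

universal⇒diamondModel : (G : Graph) → TwoConnected G → (v : V G) → (∀ {y} → y ≢ v → Adj G v y) →
                         ∀ {x d} → x ≢ d → ¬ Adj G x d → DiamondModel G
universal⇒diamondModel G (_ , _ , connected-v) v universal {x} {d} x≢d x≁d =
  let c , d′ , xc , cd′ , x≁d′ , x≢d′ , c≢v , d′≢v =
        reach-leavesNeighbourhood x (connected-v v x d x≢v d≢v) (inj₁ refl) x≁d x≢d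
  in universal+inducedPath⇒diamondModel G v universal xc cd′ x≁d′ x≢d′ x≢v c≢v d′≢v
  where
    x≢v : x ≢ v
    x≢v refl = x≁d (universal (x≢d ∘ sym))
    d≢v : d ≢ v
    d≢v refl = x≁d (adj-sym G (universal x≢d))

Outside : ∀ {k} (b c : Fin k) → Fin k → Set
Outside b c z = z ≢ b × z ≢ c

outside? : ∀ {k} (b c : Fin k) → Decidable (Outside b c)
outside? b c z = ¬? (z ≟ b) ×-dec ¬? (z ≟ c)

module SeparatingEdge (G : Graph) (two-connected : TwoConnected G) {b c : V G} (bc : Adj G b c) where

  private
    b≢c : b ≢ c
    b≢c = adj⇒≢ G bc

    connected-without : ∀ w {x y} → x ≢ w → y ≢ w → Reach G (λ z → z ≢ w) x y
    connected-without w = proj₂ (proj₂ two-connected) w _ _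

  approach-b : ∀ {z} → Outside b c z → ∃ λ p → Reach G (Outside b c) z p × Adj G p b
  approach-b (z≢b , z≢c) =
    let p , r , pb = reach-lastStep (connected-without c z≢c b≢c) z≢b
    in p , reach-mono (λ (p≢c , p≢b) → p≢b , p≢c) r , pb

  approach-c : ∀ {z} → Outside b c z → ∃ λ p → Reach G (Outside b c) z p × Adj G p c
  approach-c (z≢b , z≢c) = reach-lastStep (connected-without b z≢b (b≢c ∘ sym)) z≢c

  reach-propagates : ∀ s {a a′} → Outside b c a → Reach G (Outside b c) s a → Adj G a a′ → Outside b c a′ →
                     Reach G (Outside b c) s a′
  reach-propagates s _ r aa′ a′-out = reach-snoc r aa′ a′-out

  unreach-propagates : ∀ s {a a′} → Outside b c a → ¬ Reach G (Outside b c) s a → Adj G a a′ → Outside b c a′ →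
                       ¬ Reach G (Outside b c) s a′
  unreach-propagates s a-out ¬r aa′ _ r = ¬r (reach-snoc r (adj-sym G aa′) a-out)

  module Split {x y : V G} (x-out : Outside b c x) (y-out : Outside b c y) (x↛y : ¬ Reach G (Outside b c) x y) where

    FromX FromY : V G → Set
    FromX = Reach G (Outside b c) x
    FromY = Reach G (Outside b c) y

    fromX? : Decidable FromX
    fromX? = reach? G (outside? b c) x

    fromY? : Decidable FromY
    fromY? = reach? G (outside? b c) y

    -- The component of x in G - b - c, b with the components of neither x nor y, c, the component of y.
    branch : V G → Fin 4
    branch z with z ≟ b | z ≟ c | fromX? z | fromY? z
    ... | yes _ | _     | _     | _     = 1F
    ... | no _  | yes _ | _     | _     = 2F
    ... | no _  | no _  | yes _ | _     = 0F
    ... | no _  | no _  | no _  | yes _ = 3F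
    ... | no _  | no _  | no _  | no _  = 1F

    branch-b : branch b ≡ 1F
    branch-b with b ≟ b
    ... | yes _  = refl
    ... | no b≢b = contradiction refl b≢b

    branch-c : branch c ≡ 2F
    branch-c with c ≟ b | c ≟ c
    ... | yes c≡b | _      = contradiction (sym c≡b) b≢c
    ... | no _    | yes _  = refl
    ... | no _    | no c≢c = contradiction refl c≢c

    branch-X : ∀ {z} → Outside b c z → FromX z → branch z ≡ 0F
    branch-X {z} (z≢b , z≢c) rx with z ≟ b | z ≟ c | fromX? z
    ... | yes z≡b | _       | _      = contradiction z≡b z≢b
    ... | no _    | yes z≡c | _      = contradiction z≡c z≢c
    ... | no _    | no _    | yes _  = refl
    ... | no _    | no _    | no ¬rx = contradiction rx ¬rx

    branch-Y : ∀ {z} → Outside b c z → ¬ FromX z → FromY z → branch z ≡ 3F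
    branch-Y {z} (z≢b , z≢c) ¬rx ry with z ≟ b | z ≟ c | fromX? z | fromY? z
    ... | yes z≡b | _       | _      | _      = contradiction z≡b z≢b
    ... | no _    | yes z≡c | _      | _      = contradiction z≡c z≢c
    ... | no _    | no _    | yes rx | _      = contradiction rx ¬rx
    ... | no _    | no _    | no _   | yes _  = refl
    ... | no _    | no _    | no _   | no ¬ry = contradiction ry ¬ry

    branch-other : ∀ {z} → Outside b c z → ¬ FromX z → ¬ FromY z → branch z ≡ 1F
    branch-other {z} (z≢b , z≢c) ¬rx ¬ry with z ≟ b | z ≟ c | fromX? z | fromY? z
    ... | yes z≡b | _       | _      | _      = contradiction z≡b z≢b
    ... | no _    | yes z≡c | _      | _      = contradiction z≡c z≢c
    ... | no _    | no _    | yes rx | _      = contradiction rx ¬rx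
    ... | no _    | no _    | no _   | yes ry = contradiction ry ¬ry
    ... | no _    | no _    | no _   | no _   = refl

    branch≡0 : ∀ {z} → branch z ≡ 0F → Outside b c z × FromX z
    branch≡0 {z} _ with z ≟ b | z ≟ c | fromX? z | fromY? z
    branch≡0 () | yes _   | _       | _       | _
    branch≡0 () | no _    | yes _   | _       | _
    branch≡0 _  | no z≢b  | no z≢c  | yes rx  | _ = (z≢b , z≢c) , rx
    branch≡0 () | no _    | no _    | no _    | yes _
    branch≡0 () | no _    | no _    | no _    | no _

    branch≡1 : ∀ {z} → branch z ≡ 1F → z ≡ b ⊎ Outside b c z × ¬ FromX z × ¬ FromY z
    branch≡1 {z} _ with z ≟ b | z ≟ c | fromX? z | fromY? z
    branch≡1 _  | yes z≡b | _       | _       | _       = inj₁ z≡b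
    branch≡1 () | no _    | yes _   | _       | _
    branch≡1 () | no _    | no _    | yes _   | _
    branch≡1 () | no _    | no _    | no _    | yes _
    branch≡1 _  | no z≢b  | no z≢c  | no ¬rx  | no ¬ry  = inj₂ ((z≢b , z≢c) , ¬rx , ¬ry)

    branch≡2 : ∀ {z} → branch z ≡ 2F → z ≡ c
    branch≡2 {z} _ with z ≟ b | z ≟ c | fromX? z | fromY? z
    branch≡2 () | yes _ | _       | _     | _
    branch≡2 _  | no _  | yes z≡c | _     | _     = z≡c
    branch≡2 () | no _  | no _    | yes _ | _
    branch≡2 () | no _  | no _    | no _  | yes _
    branch≡2 () | no _  | no _    | no _  | no _

    branch≡3 : ∀ {z} → branch z ≡ 3F → Outside b c z × ¬ FromX z × FromY z
    branch≡3 {z} _ with z ≟ b | z ≟ c | fromX? z | fromY? z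
    branch≡3 () | yes _   | _       | _       | _
    branch≡3 () | no _    | yes _   | _       | _
    branch≡3 () | no _    | no _    | yes _   | _
    branch≡3 _  | no z≢b  | no z≢c  | no ¬rx  | yes ry = (z≢b , z≢c) , ¬rx , ry
    branch≡3 () | no _    | no _    | no _    | no _

    connected : ∀ i {z z′} → branch z ≡ i → branch z′ ≡ i → Reach G (λ w → branch w ≡ i) z z′
    connected 0F bz bz′ with branch≡0 bz | branch≡0 bz′
    ... | _ , rxz | _ , rxz′ =
      reach-mono (λ (w-out , rxw) → branch-X w-out rxw)
                 (reach-invariant (reach-propagates x) rxz (reach-++ (reach-reverse rxz) rxz′))
    connected 1F bz bz′ = reach-++ (toB bz) (reach-reverse (toB bz′))
      where
        propagates : ∀ {a a′} → Outside b c a → ¬ FromX a × ¬ FromY a → Adj G a a′ → Outside b c a′ →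
                     ¬ FromX a′ × ¬ FromY a′
        propagates a-out (¬rxa , ¬rya) aa′ a′-out =
          unreach-propagates x a-out ¬rxa aa′ a′-out , unreach-propagates y a-out ¬rya aa′ a′-out
        toB : ∀ {z} → branch z ≡ 1F → Reach G (λ w → branch w ≡ 1F) z b
        toB bz with branch≡1 bz
        ... | inj₁ refl = here branch-b
        ... | inj₂ (z-out , ¬rxz , ¬ryz) =
          let p , r , pb = approach-b z-out
          in reach-snoc (reach-mono (λ (w-out , ¬rxw , ¬ryw) → branch-other w-out ¬rxw ¬ryw)
                                    (reach-invariant propagates (¬rxz , ¬ryz) r))
                        pb branch-b
    connected 2F bz bz′ rewrite branch≡2 bz | branch≡2 bz′ = here branch-c
    connected 3F bz bz′ with branch≡3 bz | branch≡3 bz′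
    ... | _ , ¬rxz , ryz | _ , _ , ryz′ =
      reach-mono (λ (w-out , ¬rxw , ryw) → branch-Y w-out ¬rxw ryw)
                 (reach-invariant propagates (¬rxz , ryz) (reach-++ (reach-reverse ryz) ryz′))
      where
        propagates : ∀ {a a′} → Outside b c a → ¬ FromX a × FromY a → Adj G a a′ → Outside b c a′ →
                     ¬ FromX a′ × FromY a′
        propagates a-out (¬rxa , rya) aa′ a′-out =
          unreach-propagates x a-out ¬rxa aa′ a′-out , reach-propagates y a-out rya aa′ a′-out

    fromY⇒¬fromX : ∀ {p} → FromY p → ¬ FromX p
    fromY⇒¬fromX ryp rxp = x↛y (reach-++ rxp (reach-reverse ryp))

    diamondModel : DiamondModel G
    diamondModel = record
      { branch            = branch
      ; branch-surjective = λ { 0F → x , branch-X x-out (here x-out) ; 1F → b , branch-b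
                              ; 2F → c , branch-c ; 3F → y , branch-Y y-out x↛y (here y-out) }
      ; branch-connected  = connected
      ; no-edge-03        = λ uw bu≡0 bw≡3 →
                              let _ , rxu = branch≡0 bu≡0 ; w-out , ¬rxw , _ = branch≡3 bw≡3
                              in ¬rxw (reach-snoc rxu uw w-out)
      ; joined-01 = let p , r , pb = approach-b x-out in p , b , branch-X (reach-end r) r , branch-b , pb
      ; joined-02 = let p , r , pc = approach-c x-out in p , c , branch-X (reach-end r) r , branch-c , pc
      ; joined-12 = b , c , branch-b , branch-c , bc
      ; joined-13 = let p , r , pb = approach-b y-out
                    in b , p , branch-b , branch-Y (reach-end r) (fromY⇒¬fromX r) r , adj-sym G pb
      ; joined-23 = let p , r , pc = approach-c y-out
                    in c , p , branch-c , branch-Y (reach-end r) (fromY⇒¬fromX r) r , adj-sym G pc }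

  connected-or-diamondModel : (∀ {x y} → Outside b c x → Outside b c y → Reach G (Outside b c) x y) ⊎ DiamondModel G
  connected-or-diamondModel
    with any? (λ x → any? (λ y → outside? b c x ×-dec outside? b c y ×-dec ¬? (reach? G (outside? b c) x y)))
  ... | yes (x , y , x-out , y-out , x↛y) = inj₂ (Split.diamondModel x-out y-out x↛y)
  ... | no ¬split = inj₁ connected
    where
      connected : ∀ {x y} → Outside b c x → Outside b c y → Reach G (Outside b c) x y
      connected {x} {y} x-out y-out with reach? G (outside? b c) x y
      ... | yes r  = r
      ... | no x↛y = contradiction (x , y , x-out , y-out , x↛y) ¬split

-- Graphs of maximum degree two

least-witness : {R : ℕ → Set} → Decidable R → ∀ {k} → R k → ∃ λ J → R J × (∀ {j} → j < J → ¬ R j)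
least-witness {R} R? {k} Rk with search (suc k)
  where
    search : ∀ b → (∀ {j} → j < b → ¬ R j) ⊎ ∃ λ J → R J × (∀ {j} → j < J → ¬ R j)
    search zero = inj₁ λ ()
    search (suc b) with search b
    ... | inj₂ found = inj₂ found
    ... | inj₁ none with R? b
    ...   | yes Rb = inj₂ (b , Rb , none)
    ...   | no ¬Rb = inj₁ λ j<1+b → [ none , (λ { refl → ¬Rb }) ]′ (ℕ.m≤n⇒m<n∨m≡n (ℕ.≤-pred j<1+b))
... | inj₁ none  = contradiction Rk (none (ℕ.n<1+n k))
... | inj₂ found = found

third-element : ∀ {k} → 3 ≤ k → (a b : Fin k) → ∃ λ c → c ≢ a × c ≢ b
third-element (s≤s (s≤s (s≤s _))) a b with 0F ≟ a | 0F ≟ b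
... | no 0≢a   | no 0≢b = 0F , 0≢a , 0≢b
... | yes refl | _ with 1F ≟ b
...   | no 1≢b   = 1F , (λ ()) , 1≢b
...   | yes refl = 2F , (λ ()) , (λ ())
third-element (s≤s (s≤s (s≤s _))) a b | no 0≢a | yes refl with 1F ≟ a
...   | no 1≢a   = 1F , 1≢a , (λ ())
...   | yes refl = 2F , (λ ()) , (λ ())

two-neighbours : (G : Graph) → TwoConnected G → ∀ x → ∃₂ λ y z → y ≢ z × Adj G x y × Adj G x z
two-neighbours G (3≤n , connected , connected-without) x =
  let y , y≢x , _    = third-element 3≤n x x
      p , _ , px     = reach-lastStep (connected y x) y≢x
      q , q≢x , q≢p  = third-element 3≤n x p
      p′ , r , p′x   = reach-lastStep (connected-without p q x q≢p (adj⇒≢ G px ∘ sym)) q≢x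
  in p , p′ , proj₁ (reach-end r) ∘ sym , adj-sym G px , adj-sym G p′x

MaxDegree≤2 : Graph → Set
MaxDegree≤2 G = ∀ {x y z w} → Adj G x y → Adj G x z → Adj G x w → y ≡ z ⊎ y ≡ w ⊎ z ≡ w

-- The second component of IsCycle, with the number of vertices as a parameter so that it can be
-- established for the first return time of a walk and then transported to n G.
CyclicOrder : (G : Graph) → ℕ → Set
CyclicOrder G m = Σ (Fin m ↔ V G) λ σ → ∀ i j →
  Adj G (Inverse.to σ i) (Inverse.to σ j) ⇔ (CycSucc m i j ⊎ CycSucc m j i)

module NonBacktrackingWalk (G : Graph) (two-connected : TwoConnected G) (max≤2 : MaxDegree≤2 G) where

  private
    nbr₁ nbr₂ : V G → V G
    nbr₁ x = proj₁ (two-neighbours G two-connected x)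
    nbr₂ x = proj₁ (proj₂ (two-neighbours G two-connected x))

    nbr₁≢nbr₂ : ∀ x → nbr₁ x ≢ nbr₂ x
    nbr₁≢nbr₂ x = proj₁ (proj₂ (proj₂ (two-neighbours G two-connected x)))

    adj-nbr₁ : ∀ x → Adj G x (nbr₁ x)
    adj-nbr₁ x = proj₁ (proj₂ (proj₂ (proj₂ (two-neighbours G two-connected x))))

    adj-nbr₂ : ∀ x → Adj G x (nbr₂ x)
    adj-nbr₂ x = proj₂ (proj₂ (proj₂ (proj₂ (two-neighbours G two-connected x))))

  next : V G → V G → V G
  next p x with nbr₁ x ≟ p
  ... | yes _ = nbr₂ x
  ... | no _  = nbr₁ x

  next-adj : ∀ p x → Adj G x (next p x)
  next-adj p x with nbr₁ x ≟ p
  ... | yes _ = adj-nbr₂ x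
  ... | no _  = adj-nbr₁ x

  next-≢ : ∀ p x → next p x ≢ p
  next-≢ p x with nbr₁ x ≟ p
  ... | yes nbr₁≡p = λ nbr₂≡p → nbr₁≢nbr₂ x (trans nbr₁≡p (sym nbr₂≡p))
  ... | no nbr₁≢p  = nbr₁≢p

  start : V G
  start = fromℕ< (ℕ.<-≤-trans (s≤s z≤n) (proj₁ two-connected))

  walk : ℕ → V G
  walk zero          = start
  walk (suc zero)    = next start start
  walk (suc (suc k)) = next (walk k) (walk (suc k))

  walk-adj : ∀ k → Adj G (walk k) (walk (suc k))
  walk-adj zero    = next-adj start start
  walk-adj (suc k) = next-adj (walk k) (walk (suc k))

  walk-nonbacktracking : ∀ k → walk (suc (suc k)) ≢ walk k
  walk-nonbacktracking k = next-≢ (walk k) (walk (suc k))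

  walk-nbrs : ∀ k {w} → Adj G (walk (suc k)) w → w ≡ walk k ⊎ w ≡ walk (suc (suc k))
  walk-nbrs k kw with max≤2 (adj-sym G (walk-adj k)) (walk-adj (suc k)) kw
  ... | inj₁ k≡k+2        = contradiction (sym k≡k+2) (walk-nonbacktracking k)
  ... | inj₂ (inj₁ k≡w)   = inj₁ (sym k≡w)
  ... | inj₂ (inj₂ k+2≡w) = inj₂ (sym k+2≡w)

  no-short-return : ∀ k → walk 0 ≡ walk (suc k) → 2 ≤ k
  no-short-return zero          walk0≡walk1 = contradiction walk0≡walk1 (adj⇒≢ G (walk-adj 0))
  no-short-return (suc zero)    walk0≡walk2 = contradiction (sym walk0≡walk2) (walk-nonbacktracking 0)
  no-short-return (suc (suc _)) _           = s≤s (s≤s z≤n)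

  Repeats : ℕ → Set
  Repeats J = ∃ λ (i : Fin J) → walk (toℕ i) ≡ walk J

  repeats? : Decidable Repeats
  repeats? J = any? λ i → walk (toℕ i) ≟ walk J

  some-repeat : ∃ Repeats
  some-repeat =
    let i , j , i<j , walk-i≡walk-j = F.pigeonhole (ℕ.n<1+n (n G)) (λ (i : Fin (suc (n G))) → walk (toℕ i))
    in toℕ j , fromℕ< i<j , trans (cong walk (F.toℕ-fromℕ< i<j)) walk-i≡walk-j

  module FirstReturn {J′ : ℕ} (fresh : ∀ {j} → j < suc J′ → ¬ Repeats j)
                     {i : ℕ} (i<J : i < suc J′) (repeat : walk i ≡ walk (suc J′)) where

    J : ℕ
    J = suc J′

    distinct : ∀ {a b} → a < b → b < J → walk a ≢ walk b
    distinct a<b b<J walk-a≡walk-b = fresh b<J (fromℕ< a<b , trans (cong walk (F.toℕ-fromℕ< a<b)) walk-a≡walk-b)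

    walk-injective : ∀ {a b} → a < J → b < J → walk a ≡ walk b → a ≡ b
    walk-injective {a} {b} a<J b<J eq with ℕ.<-cmp a b
    ... | tri< a<b _ _ = contradiction eq (distinct a<b b<J)
    ... | tri≈ _ a≡b _ = a≡b
    ... | tri> _ _ b<a = contradiction (sym eq) (distinct b<a a<J)

    -- Otherwise walk J′ would be a third neighbour of walk i.
    returns-to-start : ∀ {i} → i < J → walk i ≡ walk J → i ≡ 0
    returns-to-start {zero}   _   _ = refl
    returns-to-start {suc i′} i<J repeat
      with walk-nbrs i′ (subst (λ v → Adj G v (walk J′)) (sym repeat) (adj-sym G (walk-adj J′)))
    ... | inj₁ J′≡i′ = contradiction (sym J′≡i′) (distinct (ℕ.≤-pred i<J) (ℕ.n<1+n J′))
    ... | inj₂ J′≡i′+2 with ℕ.<-cmp (suc (suc i′)) J′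
    ...   | tri< i′+2<J′ _ _ = contradiction (sym J′≡i′+2) (distinct i′+2<J′ (ℕ.n<1+n J′))
    ...   | tri≈ _ refl _    = contradiction (sym repeat) (walk-nonbacktracking (suc i′))
    ...   | tri> _ _ J′<i′+2 =
              let J′≡i′+1 = ℕ.≤-antisym (ℕ.≤-pred J′<i′+2) (ℕ.≤-pred i<J)
              in contradiction (trans (cong walk (sym J′≡i′+1)) J′≡i′+2) (adj⇒≢ G (walk-adj (suc i′)))

    closes : walk 0 ≡ walk J
    closes = subst (λ k → walk k ≡ walk J) (returns-to-start i<J repeat) repeat

    2≤J′ : 2 ≤ J′
    2≤J′ = no-short-return J′ closes

    Succ : ℕ → ℕ → Set
    Succ a b = suc a ≡ b ⊎ (suc a ≡ J × b ≡ 0)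

    neighbour-index : ∀ {k w} → k < J → Adj G (walk k) w → ∃ λ m → m < J × walk m ≡ w × (Succ k m ⊎ Succ m k)
    neighbour-index {zero} _ 0w
      with max≤2 (walk-adj 0) (subst (λ v → Adj G v (walk J′)) (sym closes) (adj-sym G (walk-adj J′))) 0w
    ... | inj₁ walk1≡walkJ′    = contradiction walk1≡walkJ′ (distinct 2≤J′ (ℕ.n<1+n J′))
    ... | inj₂ (inj₁ walk1≡w)  = 1 , ℕ.<-trans 2≤J′ (ℕ.n<1+n J′) , walk1≡w , inj₁ (inj₁ refl)
    ... | inj₂ (inj₂ walkJ′≡w) = J′ , ℕ.n<1+n J′ , walkJ′≡w , inj₂ (inj₂ (refl , refl))
    neighbour-index {suc k} k<J kw with walk-nbrs k kw
    ... | inj₁ w≡walk-k   = k , ℕ.<-trans (ℕ.n<1+n k) k<J , sym w≡walk-k , inj₂ (inj₁ refl)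
    ... | inj₂ w≡walk-k+2 with ℕ.<-cmp (suc (suc k)) J
    ...   | tri< k+2<J _ _ = suc (suc k) , k+2<J , sym w≡walk-k+2 , inj₁ (inj₁ refl)
    ...   | tri≈ _ k+2≡J _ = 0 , s≤s z≤n , trans closes (trans (cong walk (sym k+2≡J)) (sym w≡walk-k+2))
                             , inj₁ (inj₂ (k+2≡J , refl))
    ...   | tri> _ _ J<k+2 = contradiction (ℕ.<-≤-trans J<k+2 k<J) (ℕ.<-irrefl refl)

    covers : ∀ y → ∃ λ m → m < J × walk m ≡ y
    covers y = follow (proj₁ (proj₂ two-connected) (walk 0) y) (0 , s≤s z≤n , refl)
      where
        follow : ∀ {P z y} → Reach G P z y → (∃ λ m → m < J × walk m ≡ z) → ∃ λ m → m < J × walk m ≡ y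
        follow (here _)      found              = found
        follow (step _ zw r) (m , m<J , refl) =
          let m′ , m′<J , walk-m′≡w , _ = neighbour-index m<J zw in follow r (m′ , m′<J , walk-m′≡w)

    succ⇒adj : ∀ {a b} → Succ a b → Adj G (walk a) (walk b)
    succ⇒adj {a} (inj₁ refl)         = walk-adj a
    succ⇒adj {a} (inj₂ (a+1≡J , refl)) = subst (Adj G (walk a)) (trans (cong walk a+1≡J) (sym closes)) (walk-adj a)

    cyclicOrder : CyclicOrder G J
    cyclicOrder = mk↔ₛ′ to from to∘from from∘to , adj⇔succ
      where
        to : Fin J → V G
        to i = walk (toℕ i)
        from : V G → Fin J
        from y = fromℕ< (proj₁ (proj₂ (covers y)))
        to∘from : ∀ y → to (from y) ≡ y
        to∘from y = trans (cong walk (F.toℕ-fromℕ< (proj₁ (proj₂ (covers y))))) (proj₂ (proj₂ (covers y)))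
        from∘to : ∀ i → from (to i) ≡ i
        from∘to i = F.toℕ-injective (trans (F.toℕ-fromℕ< _)
                      (walk-injective (proj₁ (proj₂ (covers (to i)))) (F.toℕ<n i) (proj₂ (proj₂ (covers (to i))))))
        adj⇔succ : ∀ i j → Adj G (to i) (to j) ⇔ (CycSucc J i j ⊎ CycSucc J j i)
        adj⇔succ i j = mk⇔ adj⇒succ [ succ⇒adj , adj-sym G ∘ succ⇒adj ]′
          where
            adj⇒succ : Adj G (to i) (to j) → Succ (toℕ i) (toℕ j) ⊎ Succ (toℕ j) (toℕ i)
            adj⇒succ ij with neighbour-index (F.toℕ<n i) ij
            ... | m , m<J , walk-m≡walk-j , succ rewrite walk-injective m<J (F.toℕ<n j) walk-m≡walk-j = succ

  cyclicOrder : CyclicOrder G (n G)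
  cyclicOrder with least-witness repeats? (proj₂ some-repeat)
  ... | zero , (() , _) , _
  ... | suc J′ , (i , repeat) , fresh =
    let σ = FirstReturn.cyclicOrder fresh (F.toℕ<n i) repeat in subst (CyclicOrder G) (↔⇒≡ (proj₁ σ)) σ

maxDegree≤2⇒cycle : (G : Graph) → TwoConnected G → MaxDegree≤2 G → IsCycle G
maxDegree≤2⇒cycle G two-connected max≤2 = proj₁ two-connected , NonBacktrackingWalk.cyclicOrder G two-connected max≤2

-- Contracting an edge at a vertex of degree three

Degree≥3 : Graph → Set
Degree≥3 G = ∃ λ z → ∃ λ p₁ → ∃ λ p₂ → ∃ λ p₃ →
             Adj G z p₁ × Adj G z p₂ × Adj G z p₃ × p₁ ≢ p₂ × p₁ ≢ p₃ × p₂ ≢ p₃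

degree≥3-or-maxDegree≤2 : (G : Graph) → Degree≥3 G ⊎ MaxDegree≤2 G
degree≥3-or-maxDegree≤2 G with any? (λ z → any? (λ p₁ → any? (λ p₂ → any? (λ p₃ →
                                  adj? G z p₁ ×-dec adj? G z p₂ ×-dec adj? G z p₃ ×-dec
                                  ¬? (p₁ ≟ p₂) ×-dec ¬? (p₁ ≟ p₃) ×-dec ¬? (p₂ ≟ p₃)))))
... | yes degree≥3 = inj₁ degree≥3
... | no ¬degree≥3 = inj₂ max≤2
  where
    max≤2 : MaxDegree≤2 G
    max≤2 {x} {y} {z} {w} xy xz xw with y ≟ z | y ≟ w | z ≟ w
    ... | yes y≡z | _       | _       = inj₁ y≡z
    ... | no _    | yes y≡w | _       = inj₂ (inj₁ y≡w)
    ... | no _    | no _    | yes z≡w = inj₂ (inj₂ z≡w)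
    ... | no y≢z  | no y≢w  | no z≢w  = contradiction (x , y , z , w , xy , xz , xw , y≢z , y≢w , z≢w) ¬degree≥3

degree≥3⇒3≤n : (G : Graph) → Degree≥3 G → 3 ≤ n G
degree≥3⇒3≤n G (_ , p₁ , p₂ , p₃ , _ , _ , _ , p₁≢p₂ , p₁≢p₃ , p₂≢p₃) = F.injective⇒≤ {f = p} p-injective
  where
    p : Fin 3 → V G
    p 0F = p₁
    p 1F = p₂
    p 2F = p₃
    p-injective : ∀ {i j} → p i ≡ p j → i ≡ j
    p-injective {0F} {0F} _  = refl
    p-injective {0F} {1F} eq = contradiction eq p₁≢p₂
    p-injective {0F} {2F} eq = contradiction eq p₁≢p₃
    p-injective {1F} {0F} eq = contradiction (sym eq) p₁≢p₂
    p-injective {1F} {1F} _  = refl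
    p-injective {1F} {2F} eq = contradiction eq p₂≢p₃
    p-injective {2F} {0F} eq = contradiction (sym eq) p₁≢p₃
    p-injective {2F} {1F} eq = contradiction (sym eq) p₂≢p₃
    p-injective {2F} {2F} _  = refl

universal-or-nonNeighbour : (G : Graph) (z : V G) → (∀ {y} → y ≢ z → Adj G z y) ⊎ ∃ λ t → t ≢ z × ¬ Adj G z t
universal-or-nonNeighbour G z with any? (λ t → ¬? (t ≟ z) ×-dec ¬? (adj? G z t))
... | yes found = inj₂ found
... | no ¬found = inj₁ universal
  where
    universal : ∀ {y} → y ≢ z → Adj G z y
    universal {y} y≢z with adj? G z y
    ... | yes zy = zy
    ... | no z≁y = contradiction (y , y≢z , z≁y) ¬found

complete-or-nonEdge : (G : Graph) → IsComplete G ⊎ ∃₂ λ x y → x ≢ y × ¬ Adj G x y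
complete-or-nonEdge G with any? (λ x → any? (λ y → ¬? (x ≟ y) ×-dec ¬? (adj? G x y)))
... | yes found = inj₂ found
... | no ¬found = inj₁ complete
  where
    complete : IsComplete G
    complete x y x≢y with adj? G x y
    ... | yes xy = xy
    ... | no x≁y = contradiction (x , y , x≢y , x≁y) ¬found

cliqueAroundEdge⇒diamondModel :
  (G : Graph) {z c : V G} → Adj G z c →
  (∀ {x y} → Outside z c x → Outside z c y → x ≢ y → Adj G x y) →
  (∀ {x} → Outside z c x → Adj G x z ⊎ Adj G x c) →
  ∀ {q₁ q₂ t} → Adj G z q₁ → Adj G z q₂ → q₁ ≢ q₂ → Outside z c q₁ → Outside z c q₂ →
  Adj G c t → ¬ Adj G z t → z ≢ t → DiamondModel G
cliqueAroundEdge⇒diamondModel G {z} {c} zc clique sees {q₁} {q₂} {t} zq₁ zq₂ q₁≢q₂ q₁-out q₂-out ct z≁t z≢t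
  with universal-or-nonNeighbour G c
... | inj₁ universal =
  universal+inducedPath⇒diamondModel G c universal zq₁ (clique q₁-out t-out q₁≢t) z≁t z≢t
                                     (adj⇒≢ G zc) (proj₂ q₁-out) (proj₂ t-out)
  where
    t-out : Outside z c t
    t-out = z≢t ∘ sym , adj⇒≢ G ct ∘ sym
    q₁≢t : q₁ ≢ t
    q₁≢t q₁≡t = z≁t (subst (Adj G z) q₁≡t zq₁)
... | inj₂ (x , x≢c , c≁x) =
  diamondModel rest-connected (t , t-rest , clique x-out t-out x≢t) rest-neighbour-of-z (t , t-rest , ct)
  where
    x-out : Outside z c x
    x-out = (λ { refl → c≁x (adj-sym G zc) }) , x≢c
    xz : Adj G x z
    xz = [ (λ xz → xz) , (λ xc → contradiction (adj-sym G xc) c≁x) ]′ (sees x-out)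
    open InducedPath G xz zc (c≁x ∘ adj-sym G) x≢c using (Rest; diamondModel)
    t-out : Outside z c t
    t-out = z≢t ∘ sym , adj⇒≢ G ct ∘ sym
    x≢t : x ≢ t
    x≢t x≡t = z≁t (subst (Adj G z) x≡t (adj-sym G xz))
    t-rest : Rest t
    t-rest = x≢t ∘ sym , t-out
    rest-neighbour-of-z : ∃ λ o → Rest o × Adj G z o
    rest-neighbour-of-z with q₁ ≟ x
    ... | yes refl = q₂ , (q₁≢q₂ ∘ sym , q₂-out) , zq₂
    ... | no q₁≢x  = q₁ , (q₁≢x , q₁-out) , zq₁
    rest-connected : ∀ {y y′} → Rest y → Rest y′ → Reach G Rest y y′
    rest-connected {y} {y′} y-rest y′-rest with y ≟ y′
    ... | yes refl = here y-rest
    ... | no y≢y′  = step y-rest (clique (proj₂ y-rest) (proj₂ y′-rest) y≢y′) (here y′-rest)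

neighbour-outside : (G : Graph) {z c q : V G} → Adj G z q → q ≢ c → Outside z c q
neighbour-outside G zq q≢c = adj⇒≢ G zq ∘ sym , q≢c

neighbours-avoiding : (G : Graph) {z p₁ p₂ p₃ : V G} → Adj G z p₁ → Adj G z p₂ → Adj G z p₃ →
                      p₁ ≢ p₂ → p₁ ≢ p₃ → p₂ ≢ p₃ → ∀ c →
                      ∃₂ λ q₁ q₂ → Adj G z q₁ × Adj G z q₂ × q₁ ≢ q₂ × Outside z c q₁ × Outside z c q₂
neighbours-avoiding G {z} {p₁} {p₂} {p₃} zp₁ zp₂ zp₃ p₁≢p₂ p₁≢p₃ p₂≢p₃ c with p₁ ≟ c | p₂ ≟ c
... | yes refl | _        =
  p₂ , p₃ , zp₂ , zp₃ , p₂≢p₃ , neighbour-outside G zp₂ (p₁≢p₂ ∘ sym) , neighbour-outside G zp₃ (p₁≢p₃ ∘ sym)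
... | no p₁≢c  | yes refl =
  p₁ , p₃ , zp₁ , zp₃ , p₁≢p₃ , neighbour-outside G zp₁ p₁≢c , neighbour-outside G zp₃ (p₂≢p₃ ∘ sym)
... | no p₁≢c  | no p₂≢c  =
  p₁ , p₂ , zp₁ , zp₂ , p₁≢p₂ , neighbour-outside G zp₁ p₁≢c , neighbour-outside G zp₂ p₂≢c

module ContractedEdge (G : Graph) {z c : V G} (zc : Adj G z c) where

  open Contraction (contract G zc) public

  merged⁻¹ : ∀ {x} → φ x ≡ φ z → x ≡ z ⊎ x ≡ c
  merged⁻¹ {x} φx≡φz with φ-identifies-only-uv x z φx≡φz
  ... | inj₁ x≡z                = inj₁ x≡z
  ... | inj₂ (inj₁ (x≡z , _))   = inj₁ x≡z
  ... | inj₂ (inj₂ (x≡c , _))   = inj₂ x≡c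

  φ-outside : ∀ {x} → Outside z c x → φ x ≢ φ z
  φ-outside (x≢z , x≢c) = [ x≢z , x≢c ]′ ∘ merged⁻¹

  φ-injective-outside : ∀ {x′ x} → Outside z c x → φ x′ ≡ φ x → x′ ≡ x
  φ-injective-outside {x′} {x} (x≢z , x≢c) φx′≡φx with φ-identifies-only-uv x′ x φx′≡φx
  ... | inj₁ x′≡x               = x′≡x
  ... | inj₂ (inj₁ (_ , x≡c))   = contradiction x≡c x≢c
  ... | inj₂ (inj₂ (_ , x≡z))   = contradiction x≡z x≢z

  ψ-outside : ∀ {a} → a ≢ φ z → Outside z c (ψ a)
  ψ-outside {a} a≢φz = (λ ψa≡z → a≢φz (trans (sym (φ∘ψ a)) (cong φ ψa≡z)))
                     , (λ ψa≡c → a≢φz (trans (sym (φ∘ψ a)) (trans (cong φ ψa≡c) (sym merge))))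

  φ-adj-≢ : ∀ {x y} → Adj G x y → φ x ≢ φ y → Adj H (φ x) (φ y)
  φ-adj-≢ {x} {y} xy φx≢φy = Equivalence.from (adj⇔ φx≢φy) (x , y , refl , refl , xy)

  twoConnected : TwoConnected G → (∀ {x y} → Outside z c x → Outside z c y → Reach G (Outside z c) x y) →
                 3 ≤ n H → TwoConnected H
  twoConnected (_ , connected , connected-without) outside-connected 3≤n =
    3≤n , (λ a b → reach-project (const tt) (connected (ψ a) (ψ b))) , connected-without′
    where
      connected-without′ : ∀ w a b → a ≢ w → b ≢ w → Reach H (λ y → y ≢ w) a b
      connected-without′ w a b a≢w b≢w with w ≟ φ z
      ... | yes refl = reach-project φ-outside (outside-connected (ψ-outside a≢w) (ψ-outside b≢w))
      ... | no w≢φz  = reach-project (λ y≢ψw φy≡w → y≢ψw (φ-injective-outside ψw-out (trans φy≡w (sym (φ∘ψ w)))))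
                                     (connected-without (ψ w) (ψ a) (ψ b) (ψ-≢ a≢w) (ψ-≢ b≢w))
        where
          ψw-out : Outside z c (ψ w)
          ψw-out = ψ-outside w≢φz
          ψ-≢ : ∀ {a} → a ≢ w → ψ a ≢ ψ w
          ψ-≢ {a} a≢w ψa≡ψw = a≢w (trans (sym (φ∘ψ a)) (trans (cong φ ψa≡ψw) (φ∘ψ w)))

  complete⇒outside-clique : IsComplete H → ∀ {x y} → Outside z c x → Outside z c y → x ≢ y → Adj G x y
  complete⇒outside-clique complete {x} {y} x-out y-out x≢y =
    let x′ , y′ , φx′≡φx , φy′≡φy , x′y′ = Equivalence.to (adj⇔ φx≢φy) (complete (φ x) (φ y) φx≢φy)
    in subst₂ (Adj G) (φ-injective-outside x-out φx′≡φx) (φ-injective-outside y-out φy′≡φy) x′y′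
    where
      φx≢φy : φ x ≢ φ y
      φx≢φy = x≢y ∘ φ-injective-outside y-out

  complete⇒outside-sees-edge : IsComplete H → ∀ {x} → Outside z c x → Adj G x z ⊎ Adj G x c
  complete⇒outside-sees-edge complete {x} x-out
    with Equivalence.to (adj⇔ (φ-outside x-out)) (complete (φ x) (φ z) (φ-outside x-out))
  ... | x′ , y′ , φx′≡φx , φy′≡φz , x′y′ with φ-injective-outside x-out φx′≡φx | merged⁻¹ φy′≡φz
  ...   | refl | inj₁ refl = inj₁ x′y′
  ...   | refl | inj₂ refl = inj₂ x′y′

  degree≥3 : ∀ {q₁ q₂ t} → Adj G z q₁ → Adj G z q₂ → q₁ ≢ q₂ → Outside z c q₁ → Outside z c q₂ →
             Adj G c t → ¬ Adj G z t → z ≢ t → Degree≥3 H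
  degree≥3 {q₁} {q₂} {t} zq₁ zq₂ q₁≢q₂ q₁-out q₂-out ct z≁t z≢t =
    φ z , φ q₁ , φ q₂ , φ t , φ-adj-≢ zq₁ (φ-outside q₁-out ∘ sym) , φ-adj-≢ zq₂ (φ-outside q₂-out ∘ sym) ,
    subst (λ a → Adj H a (φ t)) (sym merge) (φ-adj-≢ ct (φ-outside t-out ∘ sym ∘ trans merge)) ,
    q₁≢q₂ ∘ φ-injective-outside q₂-out , ≢t zq₁ ∘ φ-injective-outside t-out , ≢t zq₂ ∘ φ-injective-outside t-out
    where
      t-out : Outside z c t
      t-out = z≢t ∘ sym , adj⇒≢ G ct ∘ sym
      ≢t : ∀ {q} → Adj G z q → q ≢ t
      ≢t zq refl = z≁t zq

universal⇒complete : (G : Graph) → TwoConnected G → ¬ HasDiamondContraction G →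
                     (v : V G) → (∀ {y} → y ≢ v → Adj G v y) → IsComplete G
universal⇒complete G two-connected ¬diamond v universal with complete-or-nonEdge G
... | inj₁ complete            = complete
... | inj₂ (x , y , x≢y , x≁y) =
  ⊥-elim (¬diamond (diamondModel⇒contraction (universal⇒diamondModel G two-connected v universal x≢y x≁y)))

Counterexample : Graph → Set
Counterexample G = TwoConnected G × ¬ HasDiamondContraction G × ¬ IsComplete G × Degree≥3 G

counterexample⇒smaller : ∀ {G} → Counterexample G → ∃ λ H → n H < n G × Counterexample H
counterexample⇒smaller {G} ( two-connected , ¬diamond , ¬complete
                           , z , p₁ , p₂ , p₃ , zp₁ , zp₂ , zp₃ , p₁≢p₂ , p₁≢p₃ , p₂≢p₃)
  with universal-or-nonNeighbour G z
... | inj₁ universal = ⊥-elim (¬complete (universal⇒complete G two-connected ¬diamond z universal))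
... | inj₂ (t₀ , t₀≢z , z≁t₀)
  with reach-leavesNeighbourhood z (proj₁ (proj₂ two-connected) z t₀) (inj₁ refl) z≁t₀ (t₀≢z ∘ sym)
...   | c , t , zc , ct , z≁t , z≢t , _
  with SeparatingEdge.connected-or-diamondModel G two-connected zc
     | neighbours-avoiding G zp₁ zp₂ zp₃ p₁≢p₂ p₁≢p₃ p₂≢p₃ c
...     | inj₂ D                 | _ = ⊥-elim (¬diamond (diamondModel⇒contraction D))
...     | inj₁ outside-connected | q₁ , q₂ , zq₁ , zq₂ , q₁≢q₂ , q₁-out , q₂-out =
  H , shrinks , twoConnected two-connected outside-connected (degree≥3⇒3≤n H H-degree≥3) ,
  H-¬diamond , H-¬complete , H-degree≥3
  where
    open ContractedEdge G zc
    H-degree≥3 : Degree≥3 H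
    H-degree≥3 = degree≥3 zq₁ zq₂ q₁≢q₂ q₁-out q₂-out ct z≁t z≢t
    H-¬diamond : ¬ HasDiamondContraction H
    H-¬diamond (G′ , contractions , G′≅diamond) = ¬diamond (G′ , edgeContraction ◅ contractions , G′≅diamond)
    H-¬complete : ¬ IsComplete H
    H-¬complete complete = ¬diamond (diamondModel⇒contraction
      (cliqueAroundEdge⇒diamondModel G zc (complete⇒outside-clique complete) (complete⇒outside-sees-edge complete)
                                     zq₁ zq₂ q₁≢q₂ q₁-out q₂-out ct z≁t z≢t))

¬counterexample : ∀ G → ¬ Counterexample G
¬counterexample G = go G (<-wellFounded (n G))
  where
    go : ∀ G → Acc _<_ (n G) → ¬ Counterexample G
    go G (acc rec) counterexample =
      let H , H<G , H-counterexample = counterexample⇒smaller counterexample in go H (rec H<G) H-counterexample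

lemma8 : (G : Graph) → TwoConnected G → ¬ HasDiamondContraction G →
         IsCycle G ⊎ IsComplete G
lemma8 G two-connected ¬diamond with complete-or-nonEdge G
... | inj₁ complete = inj₂ complete
... | inj₂ (x , y , x≢y , x≁y) with degree≥3-or-maxDegree≤2 G
...   | inj₂ max≤2    = inj₁ (maxDegree≤2⇒cycle G two-connected max≤2)
...   | inj₁ degree≥3 =
  ⊥-elim (¬counterexample G (two-connected , ¬diamond , (λ complete → x≁y (complete x y x≢y)) , degree≥3))
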